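{- For every connected graph $G$, $\mathrm{Kc}(G^{**},4) = 1$, i.e., any two $4$-colorings of $G^{**}$ are Kempe equivalent.
   Context: All graphs are finite and simple. Given a graph $G$, the graph $G^{**}$ is constructed as follows. For each vertex $v$ of $G$ take an independent set $I_v$ of $\deg_G(v)$ new vertices, the sets $I_v$ pairwise disjoint. For each edge $uv$ of $G$, place one edge between a vertex of $I_u$ and a vertex of $I_v$, in such a way that all these edges are pairwise vertex-disjoint (so every vertex of $\bigcup_v I_v$ is incident to exactly one of them); call the result $G^*$. Then, for each vertex $v$ of $G$, add two new vertices $x_v,y_v$, joined to each other and to every vertex of $I_v$; the result is $G^{**}$. A $4$-coloring is a map $c:V\to\{1,2,3,4\}$ with adjacent vertices receiving different colors. For distinct colors $i,j$, a Kempe change swaps $i$ and $j$ on one connected component of the subgraph induced by vertices colored $i$ or $j$. Two $4$-colorings are Kempe equivalent if one is obtained from the other by a finite sequence of Kempe changes; $\mathrm{Kc}(H,4)$ denotes the number of Kempe equivalence classes of $4$-colorings of $H$. -}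

module Defs where

open import Data.Nat using (ℕ)
open import Data.Fin using (Fin)
open import Data.Bool using (Bool; true; false; T)
open import Data.Product using (Σ; _×_; _,_; ∃)
open import Data.Sum using (_⊎_; inj₁; inj₂)
open import Data.Empty using (⊥)
open import Relation.Nullary using (¬_)
open import Relation.Binary.PropositionalEquality using (_≡_; _≢_)
open import Relation.Binary.Construct.Closure.ReflexiveTransitive using (Star)

record SimpleGraph : Set where
  field
    n      : ℕ
    adj    : Fin n → Fin n → Bool
    sym    : ∀ u v → adj u v ≡ adj v u
    irrefl : ∀ v → adj v v ≡ false

Edge : (G : SimpleGraph) → Fin (SimpleGraph.n G) → Fin (SimpleGraph.n G) → Set
Edge G u v = T (SimpleGraph.adj G u v)

Connected : SimpleGraph → Set
Connected G = ∀ u v → Star (Edge G) u v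

-- General (loopless, symmetric) graphs on an arbitrary vertex type,
-- used for G** whose vertex set is not literally Fin m.

record Graph : Set₁ where
  field
    V : Set
    E : V → V → Set

-- I_v is realised as the set of half-edges (v , w) with vw ∈ E(G):
-- it has exactly deg(v) elements, and the G*-edge for uv joins
-- (u , v) ∈ I_u with (v , u) ∈ I_v (a perfect matching on ⋃ I_v).
-- Each vertex v gets two apex vertices (v , false) = x_v, (v , true) = y_v.

module _ (G : SimpleGraph) where
  open SimpleGraph G

  HalfEdge : Set
  HalfEdge = Σ (Fin n × Fin n) (λ p → T (adj (Data.Product.proj₁ p) (Data.Product.proj₂ p)))

  VStarStar : Set
  VStarStar = HalfEdge ⊎ (Fin n × Bool)

  EStarStar : VStarStar → VStarStar → Set
  EStarStar (inj₁ ((v , w) , _)) (inj₁ ((v' , w') , _)) = (v' ≡ w) × (w' ≡ v)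
  EStarStar (inj₁ ((v , w) , _)) (inj₂ (u , b)) = u ≡ v
  EStarStar (inj₂ (u , b)) (inj₁ ((v , w) , _)) = u ≡ v
  EStarStar (inj₂ (u , b)) (inj₂ (u' , b')) = (u ≡ u') × (b ≢ b')

_** : SimpleGraph → Graph
G ** = record { V = VStarStar G ; E = EStarStar G }

module _ (H : Graph) (k : ℕ) where
  open Graph H

  IsColoring : (V → Fin k) → Set
  IsColoring c = ∀ u v → E u v → c u ≢ c v

  Coloring : Set
  Coloring = Σ (V → Fin k) IsColoring

  InIJ : (V → Fin k) → Fin k → Fin k → V → Set
  InIJ c i j v = (c v ≡ i) ⊎ (c v ≡ j)

  EdgeIJ : (V → Fin k) → Fin k → Fin k → V → V → Set
  EdgeIJ c i j u v = E u v × InIJ c i j u × InIJ c i j v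

  InComponent : (V → Fin k) → Fin k → Fin k → V → V → Set
  InComponent c i j s w = InIJ c i j s × Star (EdgeIJ c i j) s w

  swap : Fin k → Fin k → Fin k → Fin k
  swap i j x with x Data.Fin.≟ i | x Data.Fin.≟ j
  ... | Relation.Nullary.yes _ | _ = j
  ... | Relation.Nullary.no _ | Relation.Nullary.yes _ = i
  ... | Relation.Nullary.no _ | Relation.Nullary.no _ = x

  KempeChange : Coloring → Coloring → Set
  KempeChange (c , _) (d , _) =
    Σ (Fin k) λ i → Σ (Fin k) λ j → Σ V λ s →
      (i ≢ j) × InIJ c i j s ×
      (∀ w → InComponent c i j s w → d w ≡ swap i j (c w)) ×
      (∀ w → ¬ InComponent c i j s w → d w ≡ c w)

  -- Kempe equivalence: finite sequence of Kempe changes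
  -- (colourings compared pointwise at the end, as functions have no
  -- extensional equality in Agda)
  KempeEquivalent : Coloring → Coloring → Set
  KempeEquivalent α β =
    Σ Coloring λ γ → Star KempeChange α γ × (∀ v → Data.Product.proj₁ γ v ≡ Data.Product.proj₁ β v)

-- Every 4-colouring of G** is Kempe equivalent to one fixed colouring: x_v ↦ 0, y_v ↦ 1, and the
-- vertex (v , w) of I_v ↦ 2 if v < w and 3 otherwise. A vertex of I_v has only three neighbours
-- (its partner in the matching, x_v and y_v), so it can be given any colour not used on x_v, y_v
-- by at most two Kempe changes that touch nothing but itself and its partner. Making I_v
-- monochromatic in this way frees the edge x_v y_v, which can then be recoloured to (0, 1);
-- doing this for every v and then putting 2 on every (v , w) with v < w forces 3 everywhere else.
-- Kempe changes are reversible, so reaching a common colouring suffices.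
module Submission where

open import Defs
open import Data.Nat using (ℕ)
import Data.Nat as ℕ
open import Data.Nat.Properties using (n<1+n)
open import Data.Fin using (Fin; _≟_; _<_; _<?_)
open import Data.Fin.Properties using (any?; ¬∀⟶∃¬; <⇒notInjective; <-asym; <-cmp)
open import Data.Fin.Patterns using (0F; 1F; 2F; 3F)
open import Data.Bool using (Bool; true; false; T; not)
import Data.Bool.Properties as Bool
open import Data.Bool.Properties using (T-irrelevant; T?)
open import Data.Product using (Σ; _×_; _,_; proj₁; proj₂; ∃)
import Data.Product.Properties as Product
open import Data.Sum using (_⊎_; inj₁; inj₂)
import Data.Sum.Properties as Sum
open import Data.List using ([]; _∷_; allFin; cartesianProduct)
open import Data.List.Membership.Propositional using (_∈_)
open import Data.List.Membership.Propositional.Properties using (∈-allFin; ∈-cartesianProduct⁺)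
open import Data.List.Relation.Unary.Any using (here; there)
open import Data.Unit using (⊤; tt)
open import Function using (_∘_; id)
open import Relation.Nullary using (¬_; Dec; yes; no; contradiction)
open import Relation.Nullary.Decidable using (_⊎-dec_)
open import Relation.Unary using (Decidable)
open import Relation.Binary using (Symmetric; DecidableEquality; tri<; tri≈; tri>)
open import Relation.Binary.PropositionalEquality
open import Relation.Binary.Construct.Closure.ReflexiveTransitive
  using (Star; ε; _◅_; _◅◅_; fold; map; reverse)

preserved-along : ∀ {A : Set} {R : A → A → Set} (P : A → Set) →
  (∀ {a b} → R a b → P a → P b) → ∀ {a b} → Star R a b → P a → P b
preserved-along P step = fold (λ a b → P a → P b) (λ r f → f ∘ step r) id

satisfy-all : ∀ {A X : Set} {R : A → A → Set} (Inv : A → Set) (P : A → X → Set) →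
  (∀ a → Inv a → ∀ x → Σ A λ b → Star R a b × Inv b × P b x × (∀ y → P a y → P b y)) →
  ∀ xs a → Inv a → Σ A λ b → Star R a b × Inv b × (∀ x → x ∈ xs → P b x)
satisfy-all Inv P step [] a inv = a , ε , inv , λ _ ()
satisfy-all Inv P step (x ∷ xs) a inv =
  let b , a⇝b , inv-b , P-b = satisfy-all Inv P step xs a inv
      c , b⇝c , inv-c , P-c-x , preserve = step b inv-b x
  in c , a⇝b ◅◅ b⇝c , inv-c , λ { _ (here refl) → P-c-x ; y (there y∈xs) → preserve y (P-b y y∈xs) }

free-colour : ∀ {m k} → m ℕ.< k → (f : Fin m → Fin k) → ∃ λ x → ∀ i → f i ≢ x
free-colour {m} {k} m<k f with ¬∀⟶∃¬ k (λ x → ∃ λ i → f i ≡ x) (λ x → any? λ i → f i ≟ x) not-onto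
  where
  not-onto : ¬ (∀ x → ∃ λ i → f i ≡ x)
  not-onto onto = <⇒notInjective m<k λ {x} {y} eq →
    trans (sym (proj₂ (onto x))) (trans (cong f eq) (proj₂ (onto y)))
... | x , x∉f = x , λ i fi≡x → x∉f (i , fi≡x)

free-colour₃ : (a b c : Fin 4) → ∃ λ x → a ≢ x × b ≢ x × c ≢ x
free-colour₃ a b c =
  let x , x-free = free-colour (n<1+n 3) λ { 0F → a ; 1F → b ; 2F → c }
  in x , x-free 0F , x-free 1F , x-free 2F

free-colour-or-distinct : (x y a b : Fin 4) →
  (∃ λ d → x ≢ d × y ≢ d × a ≢ d × b ≢ d) ⊎ (x ≢ a × x ≢ b × y ≢ a × y ≢ b)
free-colour-or-distinct x y a b with x ≟ a | x ≟ b | y ≟ a | y ≟ b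
... | yes refl | _ | _ | _ =
  let d , x≢d , y≢d , b≢d = free-colour₃ x y b in inj₁ (d , x≢d , y≢d , x≢d , b≢d)
... | no _ | yes refl | _ | _ =
  let d , x≢d , y≢d , a≢d = free-colour₃ x y a in inj₁ (d , x≢d , y≢d , a≢d , x≢d)
... | no _ | no _ | yes refl | _ =
  let d , x≢d , y≢d , b≢d = free-colour₃ x y b in inj₁ (d , x≢d , y≢d , y≢d , b≢d)
... | no _ | no _ | no _ | yes refl =
  let d , x≢d , y≢d , a≢d = free-colour₃ x y a in inj₁ (d , x≢d , y≢d , a≢d , y≢d)
... | no x≢a | no x≢b | no y≢a | no y≢b = inj₂ (x≢a , x≢b , y≢a , y≢b)

forced-3F : ∀ {x : Fin 4} → x ≢ 0F → x ≢ 1F → x ≢ 2F → x ≡ 3F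
forced-3F {0F} x≢0 _ _ = contradiction refl x≢0
forced-3F {1F} _ x≢1 _ = contradiction refl x≢1
forced-3F {2F} _ _ x≢2 = contradiction refl x≢2
forced-3F {3F} _ _ _ = refl

module KempeChains (H : Graph) (k : ℕ)
  (E-sym : Symmetric (Graph.E H)) (_≟ᵥ_ : DecidableEquality (Graph.V H)) where
  open Graph H

  colour : Coloring H k → V → Fin k
  colour = proj₁

  _⇝_ _⇝*_ : Coloring H k → Coloring H k → Set
  _⇝_ = KempeChange H k
  _⇝*_ = Star _⇝_

  module _ (i j : Fin k) where

    swap-left : swap H k i j i ≡ j
    swap-left with i ≟ i
    ... | yes _ = refl
    ... | no i≢i = contradiction refl i≢i

    swap-right : swap H k i j j ≡ i
    swap-right with j ≟ i | j ≟ j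
    ... | yes j≡i | _ = j≡i
    ... | no _ | yes _ = refl
    ... | no _ | no j≢j = contradiction refl j≢j

    swap-other : ∀ {x} → x ≢ i → x ≢ j → swap H k i j x ≡ x
    swap-other {x} x≢i x≢j with x ≟ i | x ≟ j
    ... | yes x≡i | _ = contradiction x≡i x≢i
    ... | no _ | yes x≡j = contradiction x≡j x≢j
    ... | no _ | no _ = refl

    swap-involutive : ∀ x → swap H k i j (swap H k i j x) ≡ x
    swap-involutive x with x ≟ i | x ≟ j
    ... | yes refl | _ = swap-right
    ... | no _ | yes refl = swap-left
    ... | no x≢i | no x≢j = swap-other x≢i x≢j

    swap-injective : ∀ {x y} → swap H k i j x ≡ swap H k i j y → x ≡ y
    swap-injective {x} {y} eq = begin
      x                                   ≡⟨ swap-involutive x ⟨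
      swap H k i j (swap H k i j x)       ≡⟨ cong (swap H k i j) eq ⟩
      swap H k i j (swap H k i j y)       ≡⟨ swap-involutive y ⟩
      y                                   ∎
      where open ≡-Reasoning

    swap-pair : ∀ {x} → (x ≡ i) ⊎ (x ≡ j) → (swap H k i j x ≡ i) ⊎ (swap H k i j x ≡ j)
    swap-pair (inj₁ refl) = inj₂ swap-left
    swap-pair (inj₂ refl) = inj₁ swap-right

  module _ (c : V → Fin k) (i j : Fin k) where

    InIJ? : Decidable (InIJ H k c i j)
    InIJ? v = (c v ≟ i) ⊎-dec (c v ≟ j)

    InIJ-along : ∀ {u w} → Star (EdgeIJ H k c i j) u w → InIJ H k c i j u → InIJ H k c i j w
    InIJ-along = preserved-along (InIJ H k c i j) (λ (_ , _ , w-ij) _ → w-ij)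

  component-swap⇒KempeChange : ∀ (c d : Coloring H k) {i j s} (K : V → Set) →
    i ≢ j → InIJ H k (colour c) i j s → K s →
    (∀ {w} → K w → Star (EdgeIJ H k (colour c) i j) s w) →
    (∀ {u w} → EdgeIJ H k (colour c) i j u w → K u → K w) →
    (∀ w → K w → colour d w ≡ swap H k i j (colour c w)) →
    (∀ w → ¬ K w → colour d w ≡ colour c w) →
    c ⇝ d
  component-swap⇒KempeChange c d {i} {j} {s} K i≢j s-ij Ks reach closed inK outK =
    i , j , s , i≢j , s-ij ,
    (λ w (_ , s⇝w) → inK w (preserved-along K closed s⇝w Ks)) ,
    (λ w w∉C → outK w (λ Kw → w∉C (s-ij , reach Kw)))

  kempeChange-sym : ∀ {c d} → c ⇝ d → d ⇝ c
  kempeChange-sym {c , c-ok} {d , d-ok} (i , j , s , i≢j , s-ij , inC , outC) =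
    component-swap⇒KempeChange (d , d-ok) (c , c-ok) C i≢j ds-ij Cs reach closed inC′ outC′
    where
    C = InComponent H k c i j s
    Cs : C s
    Cs = s-ij , ε
    C⊆IJ : ∀ {w} → C w → InIJ H k c i j w
    C⊆IJ (_ , s⇝w) = InIJ-along c i j s⇝w s-ij
    C-extend : ∀ {u w} → EdgeIJ H k c i j u w → C u → C w
    C-extend e (_ , s⇝u) = s-ij , s⇝u ◅◅ (e ◅ ε)
    swapped-IJ : ∀ {w} → C w → InIJ H k d i j w
    swapped-IJ {w} Cw = subst (λ x → (x ≡ i) ⊎ (x ≡ j)) (sym (inC w Cw)) (swap-pair i j (C⊆IJ Cw))
    ds-ij = swapped-IJ Cs
    reach : ∀ {w} → C w → Star (EdgeIJ H k d i j) s w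
    reach (_ , s⇝w) = fold (λ a b → C a → Star (EdgeIJ H k d i j) a b)
      (λ e@(uw , _) rest Cu → (uw , swapped-IJ Cu , swapped-IJ (C-extend e Cu)) ◅ rest (C-extend e Cu))
      (λ _ → ε) s⇝w Cs
    closed : ∀ {u w} → EdgeIJ H k d i j u w → C u → C w
    closed {u} {w} (uw , _ , dw-ij) Cu with InIJ? c i j w
    ... | yes cw-ij = C-extend (uw , C⊆IJ Cu , cw-ij) Cu
    ... | no cw∉ij = contradiction
          (subst (λ x → (x ≡ i) ⊎ (x ≡ j)) (outC w (cw∉ij ∘ C⊆IJ)) dw-ij) cw∉ij
    inC′ : ∀ w → C w → c w ≡ swap H k i j (d w)
    inC′ w Cw = trans (sym (swap-involutive i j (c w))) (cong (swap H k i j) (sym (inC w Cw)))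
    outC′ : ∀ w → ¬ C w → c w ≡ d w
    outC′ w w∉C = sym (outC w w∉C)

  kempeChange-respects-≗ : ∀ {c c′ d} → (∀ v → colour c v ≡ colour c′ v) → c ⇝ d → c′ ⇝ d
  kempeChange-respects-≗ {c , _} {c′ , _} c≗c′ (i , j , s , i≢j , s-ij , inC , outC) =
    i , j , s , i≢j , IJ→ s-ij ,
    (λ w C′w → trans (inC w (component← C′w)) (cong (swap H k i j) (c≗c′ w))) ,
    (λ w w∉C′ → trans (outC w (w∉C′ ∘ component→)) (c≗c′ w))
    where
    IJ→ : ∀ {v} → InIJ H k c i j v → InIJ H k c′ i j v
    IJ→ {v} = subst (λ x → (x ≡ i) ⊎ (x ≡ j)) (c≗c′ v)
    IJ← : ∀ {v} → InIJ H k c′ i j v → InIJ H k c i j v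
    IJ← {v} = subst (λ x → (x ≡ i) ⊎ (x ≡ j)) (sym (c≗c′ v))
    component→ : ∀ {w} → InComponent H k c i j s w → InComponent H k c′ i j s w
    component→ (s-ij , p) = IJ→ s-ij , map (λ (e , u-ij , w-ij) → e , IJ→ u-ij , IJ→ w-ij) p
    component← : ∀ {w} → InComponent H k c′ i j s w → InComponent H k c i j s w
    component← (s-ij , p) = IJ← s-ij , map (λ (e , u-ij , w-ij) → e , IJ← u-ij , IJ← w-ij) p

  swap-on : ∀ (c : Coloring H k) {i j s} (K : V → Set) → Decidable K →
    i ≢ j → InIJ H k (colour c) i j s → K s →
    (∀ {w} → K w → Star (EdgeIJ H k (colour c) i j) s w) →
    (∀ {u w} → EdgeIJ H k (colour c) i j u w → K u → K w) →
    Σ (Coloring H k) λ d → c ⇝ d ×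
      (∀ w → K w → colour d w ≡ swap H k i j (colour c w)) × (∀ w → ¬ K w → colour d w ≡ colour c w)
  swap-on (c , c-ok) {i} {j} {s} K K? i≢j s-ij Ks reach closed =
    d , component-swap⇒KempeChange (c , c-ok) d K i≢j s-ij Ks reach closed inK outK , inK , outK
    where
    σ = swap H k i j
    d′ : V → Fin k
    d′ w with K? w
    ... | yes _ = σ (c w)
    ... | no _ = c w
    inK : ∀ w → K w → d′ w ≡ σ (c w)
    inK w Kw with K? w
    ... | yes _ = refl
    ... | no w∉K = contradiction Kw w∉K
    outK : ∀ w → ¬ K w → d′ w ≡ c w
    outK w w∉K with K? w
    ... | yes Kw = contradiction Kw w∉K
    ... | no _ = refl
    -- an edge leaving K cannot become monochromatic: its outer end would join the component
    boundary : ∀ {u w} → E u w → K u → ¬ K w → σ (c u) ≢ c w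
    boundary uw Ku w∉K eq = w∉K (closed (uw , u-ij , subst (λ x → (x ≡ i) ⊎ (x ≡ j)) eq (swap-pair i j u-ij)) Ku)
      where u-ij = InIJ-along c i j (reach Ku) s-ij
    d-ok : IsColoring H k d′
    d-ok u w uw with K? u | K? w
    ... | yes _ | yes _ = c-ok u w uw ∘ swap-injective i j
    ... | yes Ku | no w∉K = boundary uw Ku w∉K
    ... | no u∉K | yes Kw = boundary (E-sym uw) Kw u∉K ∘ sym
    ... | no _ | no _ = c-ok u w uw
    d = d′ , d-ok

  recolour : ∀ (c : Coloring H k) s j → (∀ {u} → E s u → colour c u ≢ j) →
    Σ (Coloring H k) λ d → c ⇝* d × colour d s ≡ j × (∀ u → u ≢ s → colour d u ≡ colour c u)
  recolour c s j nbrs≢j with colour c s ≟ j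
  ... | yes cs≡j = c , ε , cs≡j , λ _ _ → refl
  ... | no cs≢j =
    let d , c⇝d , inK , outK = swap-on c (_≡ s) (_≟ᵥ s) cs≢j (inj₁ refl) refl (λ { refl → ε }) closed
    in d , c⇝d ◅ ε , trans (inK s refl) (swap-left (colour c s) j) , outK
    where
    closed : ∀ {u w} → EdgeIJ H k (colour c) (colour c s) j u w → u ≡ s → w ≡ s
    closed {w = w} (sw , _ , inj₁ cw≡cs) refl = contradiction (sym cw≡cs) (proj₂ c s w sw)
    closed (sw , _ , inj₂ cw≡j) refl = contradiction cw≡j (nbrs≢j sw)

  swap-edge : ∀ (c : Coloring H k) {h p} → E h p →
    (∀ {u} → E h u → u ≢ p → ¬ InIJ H k (colour c) (colour c h) (colour c p) u) →
    (∀ {u} → E p u → u ≢ h → ¬ InIJ H k (colour c) (colour c h) (colour c p) u) →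
    Σ (Coloring H k) λ d → c ⇝ d × colour d h ≡ colour c p ×
      (∀ u → u ≢ h → u ≢ p → colour d u ≡ colour c u)
  swap-edge c {h} {p} hp h-private p-private =
    let d , c⇝d , inK , outK = swap-on c K K? (proj₂ c h p hp) (inj₁ refl) (inj₁ refl) reach closed
    in d , c⇝d , trans (inK h (inj₁ refl)) (swap-left i j) ,
       λ u u≢h u≢p → outK u λ { (inj₁ u≡h) → u≢h u≡h ; (inj₂ u≡p) → u≢p u≡p }
    where
    i = colour c h
    j = colour c p
    K : V → Set
    K u = (u ≡ h) ⊎ (u ≡ p)
    K? : Decidable K
    K? u = (u ≟ᵥ h) ⊎-dec (u ≟ᵥ p)
    reach : ∀ {w} → K w → Star (EdgeIJ H k (colour c) i j) h w
    reach (inj₁ refl) = ε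
    reach (inj₂ refl) = (hp , inj₁ refl , inj₂ refl) ◅ ε
    closed : ∀ {u w} → EdgeIJ H k (colour c) i j u w → K u → K w
    closed {w = w} (hw , _ , w-ij) (inj₁ refl) with w ≟ᵥ p
    ... | yes w≡p = inj₂ w≡p
    ... | no w≢p = contradiction w-ij (h-private hw w≢p)
    closed {w = w} (pw , _ , w-ij) (inj₂ refl) with w ≟ᵥ h
    ... | yes w≡h = inj₁ w≡h
    ... | no w≢h = contradiction w-ij (p-private pw w≢h)

  reach-common⇒KempeEquivalent : (κ : V → Fin k) →
    (∀ α → Σ (Coloring H k) λ γ → α ⇝* γ × (∀ v → colour γ v ≡ κ v)) →
    ∀ α β → KempeEquivalent H k α β
  reach-common⇒KempeEquivalent κ reach α β =
    let γ , α⇝*γ , γ≗κ = reach α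
        δ , β⇝*δ , δ≗κ = reach β
    in join α⇝*γ (λ v → trans (γ≗κ v) (sym (δ≗κ v))) (reverse (λ {x} {y} → kempeChange-sym {x} {y}) β⇝*δ)
    where
    join : ∀ {γ δ} → α ⇝* γ → (∀ v → colour γ v ≡ colour δ v) → δ ⇝* β → KempeEquivalent H k α β
    join {γ} α⇝*γ γ≗β ε = γ , α⇝*γ , γ≗β
    join {γ} {δ} α⇝*γ γ≗δ (_◅_ {j = x} δ⇝x x⇝*β) =
      β , α⇝*γ ◅◅ (kempeChange-respects-≗ {δ} {γ} {x} (λ v → sym (γ≗δ v)) δ⇝x ◅ x⇝*β) , λ _ → refl

module DoubleStar (G : SimpleGraph) where
  open SimpleGraph G renaming (sym to adj-sym)

  half : (v w : Fin n) → T (adj v w) → VStarStar G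
  half v w t = inj₁ ((v , w) , t)

  apex : Fin n → Bool → VStarStar G
  apex v b = inj₂ (v , b)

  flip : ∀ {v w} → T (adj v w) → T (adj w v)
  flip {v} {w} = subst T (adj-sym v w)

  no-loop : ∀ {v} → ¬ T (adj v v)
  no-loop {v} = subst T (irrefl v)

  half-irrelevant : ∀ {v w} (t t′ : T (adj v w)) → half v w t ≡ half v w t′
  half-irrelevant t t′ = cong (half _ _) (T-irrelevant t t′)

  half-injective : ∀ {v w v′ w′ t t′} → half v w t ≡ half v′ w′ t′ → (v , w) ≡ (v′ , w′)
  half-injective refl = refl

  E-sym : Symmetric (EStarStar G)
  E-sym {inj₁ _} {inj₁ _} (refl , refl) = refl , refl
  E-sym {inj₁ _} {inj₂ _} uv = uv
  E-sym {inj₂ _} {inj₁ _} uv = uv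
  E-sym {inj₂ _} {inj₂ _} (refl , b≢b′) = refl , b≢b′ ∘ sym

  _≟ᵥ_ : DecidableEquality (VStarStar G)
  _≟ᵥ_ = Sum.≡-dec (Product.≡-dec (Product.≡-dec _≟_ _≟_) λ t t′ → yes (T-irrelevant t t′))
                   (Product.≡-dec _≟_ Bool._≟_)

  open KempeChains (G **) 4 E-sym _≟ᵥ_ public

  half-neighbour : ∀ {v w t u} → EStarStar G (half v w t) u →
    (u ≡ half w v (flip t)) ⊎ (∃ λ b → u ≡ apex v b)
  half-neighbour {u = inj₁ ((_ , _) , t′)} (refl , refl) = inj₁ (half-irrelevant t′ _)
  half-neighbour {u = inj₂ (_ , b)} refl = inj₂ (b , refl)

  apex-neighbour : ∀ {v b u} → EStarStar G (apex v b) u →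
    (u ≡ apex v (not b)) ⊎ (∃ λ w → Σ (T (adj v w)) λ t → u ≡ half v w t)
  apex-neighbour {u = inj₁ ((_ , w) , t)} refl = inj₂ (w , t , refl)
  apex-neighbour {b = false} {inj₂ (_ , false)} (refl , b≢b′) = contradiction refl b≢b′
  apex-neighbour {b = false} {inj₂ (_ , true)} (refl , _) = inj₁ refl
  apex-neighbour {b = true} {inj₂ (_ , false)} (refl , _) = inj₁ refl
  apex-neighbour {b = true} {inj₂ (_ , true)} (refl , b≢b′) = contradiction refl b≢b′

  half-neighbours-avoid : ∀ c {v w t j} →
    colour c (half w v (flip t)) ≢ j → (∀ b → colour c (apex v b) ≢ j) →
    ∀ {u} → EStarStar G (half v w t) u → colour c u ≢ j
  half-neighbours-avoid c partner≢j apexes≢j hu with half-neighbour hu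
  ... | inj₁ refl = partner≢j
  ... | inj₂ (b , refl) = apexes≢j b

  apex-neighbours-avoid : ∀ c {v b j} →
    colour c (apex v (not b)) ≢ j → (∀ w t → colour c (half v w t) ≢ j) →
    ∀ {u} → EStarStar G (apex v b) u → colour c u ≢ j
  apex-neighbours-avoid c twin≢j halves≢j au with apex-neighbour au
  ... | inj₁ refl = twin≢j
  ... | inj₂ (w , t , refl) = halves≢j w t

  HalfRecoloured : Coloring (G **) 4 → (v w : Fin n) → T (adj v w) → Fin 4 → Set
  HalfRecoloured c v w t d = Σ (Coloring (G **) 4) λ c′ → c ⇝* c′ × colour c′ (half v w t) ≡ d ×
    (∀ u → u ≢ half v w t → u ≢ half w v (flip t) → colour c′ u ≡ colour c u)

  recolour-half-partner-free : ∀ c {v w t d} → (∀ b → colour c (apex v b) ≢ d) →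
    colour c (half w v (flip t)) ≢ d → HalfRecoloured c v w t d
  recolour-half-partner-free c {v} {w} {t} {d} apexes≢d partner≢d =
    let c′ , c⇝*c′ , h≡d , frame = recolour c (half v w t) d (half-neighbours-avoid c partner≢d apexes≢d)
    in c′ , c⇝*c′ , h≡d , λ u u≢h _ → frame u u≢h

  recolour-half-via-partner : ∀ c {v w t d} → (∀ b → colour c (apex v b) ≢ d) →
    (∃ λ b → colour c (apex w b) ≡ colour c (half v w t)) → HalfRecoloured c v w t d
  recolour-half-via-partner c {v} {w} {t} {d} apexes≢d (b , apex≡h)
    with free-colour₃ (colour c (apex w false)) (colour c (apex w true)) d
  ... | f , x≢f , y≢f , d≢f =
    let c₁ , c⇝*c₁ , p≡f , frame₁ = recolour c p f (half-neighbours-avoid c h≢f apexes≢f)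
        c₂ , c₁⇝*c₂ , h≡d , frame₂ = recolour-half-partner-free c₁
          (λ b e → apexes≢d b (trans (sym (frame₁ (apex v b) (λ ()))) e)) (λ e → d≢f (trans (sym e) p≡f))
    in c₂ , c⇝*c₁ ◅◅ c₁⇝*c₂ , h≡d , λ u u≢h u≢p → trans (frame₂ u u≢h u≢p) (frame₁ u u≢p)
    where
    p = half w v (flip t)
    apexes≢f : ∀ b → colour c (apex w b) ≢ f
    apexes≢f false = x≢f
    apexes≢f true = y≢f
    h≢f : colour c (half v w (flip (flip t))) ≢ f
    h≢f rewrite half-irrelevant (flip (flip t)) t = apexes≢f b ∘ trans apex≡h

  recolour-half-by-swap : ∀ c {v w t d} → (∀ b → colour c (apex v b) ≢ d) →
    (∀ b → colour c (apex w b) ≢ colour c (half v w t)) → colour c (half w v (flip t)) ≡ d →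
    HalfRecoloured c v w t d
  recolour-half-by-swap c {v} {w} {t} {d} apexes≢d apexes≢h p≡d =
    let c′ , c⇝c′ , h≡p , frame = swap-edge c (refl , refl) h-private p-private
    in c′ , c⇝c′ ◅ ε , trans h≡p p≡d , frame
    where
    h = half v w t
    p = half w v (flip t)
    h-private : ∀ {u} → EStarStar G h u → u ≢ p → ¬ InIJ (G **) 4 (colour c) (colour c h) (colour c p) u
    h-private hu u≢p u-ij with half-neighbour hu
    ... | inj₁ u≡p = u≢p u≡p
    ... | inj₂ (b , refl) with u-ij
    ...   | inj₁ a≡h = proj₂ c h (apex v b) refl (sym a≡h)
    ...   | inj₂ a≡p = apexes≢d b (trans a≡p p≡d)
    p-private : ∀ {u} → EStarStar G p u → u ≢ h → ¬ InIJ (G **) 4 (colour c) (colour c h) (colour c p) u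
    p-private pu u≢h u-ij with half-neighbour pu
    ... | inj₁ u≡h = u≢h (trans u≡h (half-irrelevant _ t))
    ... | inj₂ (b , refl) with u-ij
    ...   | inj₁ a≡h = apexes≢h b a≡h
    ...   | inj₂ a≡p = proj₂ c p (apex w b) refl (sym a≡p)

  -- If the partner already has colour d: when the colour of (v , w) occurs on x_w or y_w the
  -- partner has a free colour to move to first; otherwise the two form a whole Kempe component.
  recolour-half : ∀ c {v w t d} → (∀ b → colour c (apex v b) ≢ d) → HalfRecoloured c v w t d
  recolour-half c {v} {w} {t} {d} apexes≢d with colour c (half w v (flip t)) ≟ d
  ... | no p≢d = recolour-half-partner-free c apexes≢d p≢d
  ... | yes p≡d with colour c (apex w false) ≟ colour c (half v w t) | colour c (apex w true) ≟ colour c (half v w t)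
  ...   | yes x≡h | _ = recolour-half-via-partner c apexes≢d (false , x≡h)
  ...   | no _ | yes y≡h = recolour-half-via-partner c apexes≢d (true , y≡h)
  ...   | no x≢h | no y≢h = recolour-half-by-swap c apexes≢d (λ { false → x≢h ; true → y≢h }) p≡d

  recolour-halves : (S : Fin n → Fin n → Set) → (∀ v w → Dec (S v w)) →
    (∀ {v w} → T (adj v w) → S v w → ¬ S w v) → ∀ c d →
    (∀ {v w} → S v w → ∀ b → colour c (apex v b) ≢ d) →
    Σ (Coloring (G **) 4) λ c′ → c ⇝* c′ ×
      (∀ v b → colour c′ (apex v b) ≡ colour c (apex v b)) ×
      (∀ {v w} → S v w → ∀ t → colour c′ (half v w t) ≡ d)
  recolour-halves S S? S-asym c d apexes≢d =
    let c′ , c⇝*c′ , apexes-kept , done = satisfy-all ApexesKept Done step pairs c (λ _ _ → refl)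
    in c′ , c⇝*c′ , apexes-kept , λ {v} {w} → done (v , w) (∈-cartesianProduct⁺ (∈-allFin v) (∈-allFin w))
    where
    pairs = cartesianProduct (allFin n) (allFin n)
    ApexesKept : Coloring (G **) 4 → Set
    ApexesKept c′ = ∀ v b → colour c′ (apex v b) ≡ colour c (apex v b)
    Done : Coloring (G **) 4 → Fin n × Fin n → Set
    Done c′ (v , w) = S v w → ∀ t → colour c′ (half v w t) ≡ d
    done-here : ∀ c′ {v w t} → colour c′ (half v w t) ≡ d → Done c′ (v , w)
    done-here c′ {t = t} h≡d _ t′ = trans (cong (colour c′) (half-irrelevant t′ t)) h≡d
    -- the partner (w,v) of a recoloured half-edge (v,w) is never itself a target, by asymmetry of S
    done-elsewhere : ∀ c′ c″ {v w t} → S v w → colour c″ (half v w t) ≡ d →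
      (∀ u → u ≢ half v w t → u ≢ half w v (flip t) → colour c″ u ≡ colour c′ u) →
      ∀ yz → Done c′ yz → Done c″ yz
    done-elsewhere c′ c″ {v} {w} {t} s h≡d frame (y , z) done s′ t′
      with Product.≡-dec _≟_ _≟_ (y , z) (v , w)
    ... | yes refl = done-here c″ h≡d s′ t′
    ... | no yz≢vw = trans (frame _ (yz≢vw ∘ half-injective) not-partner) (done s′ t′)
      where
      not-partner : half y z t′ ≢ half w v (flip t)
      not-partner eq with half-injective eq
      ... | refl = S-asym t s s′
    step : ∀ c′ → ApexesKept c′ → ∀ vw → Σ (Coloring (G **) 4) λ c″ → c′ ⇝* c″ × ApexesKept c″ ×
      Done c″ vw × (∀ yz → Done c′ yz → Done c″ yz)
    step c′ kept (v , w) with S? v w | T? (adj v w)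
    ... | no ¬s | _ = c′ , ε , kept , (λ s → contradiction s ¬s) , λ _ → id
    ... | yes _ | no ¬t = c′ , ε , kept , (λ _ t → contradiction t ¬t) , λ _ → id
    ... | yes s | yes t =
      let c″ , c′⇝*c″ , h≡d , frame = recolour-half c′ {v} {w} {t} λ b e → apexes≢d s b (trans (sym (kept v b)) e)
      in c″ , c′⇝*c″ , (λ u b → trans (frame (apex u b) (λ ()) (λ ())) (kept u b)) ,
         done-here c″ h≡d , done-elsewhere c′ c″ s h≡d frame

  apex-injective : ∀ {u v b b′} → apex u b ≡ apex v b′ → u ≡ v
  apex-injective refl = refl

  ApexesAt : Coloring (G **) 4 → Fin n → Fin 4 → Fin 4 → Set
  ApexesAt c v a b = colour c (apex v false) ≡ a × colour c (apex v true) ≡ b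

  ApexesMoved : Coloring (G **) 4 → Fin n → Fin 4 → Fin 4 → Set
  ApexesMoved c v a b = Σ (Coloring (G **) 4) λ c′ → c ⇝* c′ × ApexesAt c′ v a b ×
    (∀ u b′ → u ≢ v → colour c′ (apex u b′) ≡ colour c (apex u b′))

  move-apexes-over-constant-halves : ∀ c v {a b d} → a ≢ b → a ≢ d → b ≢ d →
    (∀ w t → colour c (half v w t) ≡ d) → ApexesMoved c v a b
  move-apexes-over-constant-halves c v {a} {b} {d} a≢b a≢d b≢d halves≡d
    with free-colour₃ (colour c (apex v true)) b d
  ... | f , y≢f , b≢f , d≢f =
    let c₁ , r₁ , x₁≡f , frame₁ = recolour c (apex v false) f
          (apex-neighbours-avoid c y≢f (halves≢ c halves≡d d≢f))
        halves₁≡d = λ w t → trans (frame₁ (half v w t) (λ ())) (halves≡d w t)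
        c₂ , r₂ , y₂≡b , frame₂ = recolour c₁ (apex v true) b
          (apex-neighbours-avoid c₁ (λ e → b≢f (trans (sym e) x₁≡f)) (halves≢ c₁ halves₁≡d (b≢d ∘ sym)))
        halves₂≡d = λ w t → trans (frame₂ (half v w t) (λ ())) (halves₁≡d w t)
        c₃ , r₃ , x₃≡a , frame₃ = recolour c₂ (apex v false) a
          (apex-neighbours-avoid c₂ (λ e → a≢b (trans (sym e) y₂≡b)) (halves≢ c₂ halves₂≡d (a≢d ∘ sym)))
    in c₃ , r₁ ◅◅ r₂ ◅◅ r₃ , (x₃≡a , trans (frame₃ (apex v true) (λ ())) y₂≡b) ,
       λ u b′ u≢v → trans (frame₃ _ (u≢v ∘ apex-injective))
         (trans (frame₂ _ (u≢v ∘ apex-injective)) (frame₁ _ (u≢v ∘ apex-injective)))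
    where
    halves≢ : ∀ c′ → (∀ w t → colour c′ (half v w t) ≡ d) → ∀ {j} → d ≢ j → ∀ w t → colour c′ (half v w t) ≢ j
    halves≢ c′ halves′≡d d≢j w t e = d≢j (trans (sym (halves′≡d w t)) e)

  move-apexes : ∀ c v {a b} d → a ≢ b → a ≢ d → b ≢ d → (∀ b′ → colour c (apex v b′) ≢ d) → ApexesMoved c v a b
  move-apexes c v d a≢b a≢d b≢d apexes≢d =
    let c₁ , r₁ , kept₁ , halves₁ = recolour-halves (λ x _ → x ≡ v) (λ x _ → x ≟ v)
          (λ { t refl refl → no-loop t }) c d (λ { refl → apexes≢d })
        c₂ , r₂ , at₂ , frame₂ = move-apexes-over-constant-halves c₁ v a≢b a≢d b≢d (λ w → halves₁ refl)
    in c₂ , r₁ ◅◅ r₂ , at₂ , λ u b′ u≢v → trans (frame₂ u b′ u≢v) (kept₁ u b′)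

  -- If no colour is free of x_v, y_v, a, b, these four are distinct, and (a , y_v) is a
  -- stepping stone: reach it with b kept off I_v, then (a , b) with x_v kept off I_v.
  normalise-apexes : ∀ c v {a b} → a ≢ b → ApexesMoved c v a b
  normalise-apexes c v {a} {b} a≢b with free-colour-or-distinct x y a b
    where
    x = colour c (apex v false)
    y = colour c (apex v true)
  ... | inj₁ (d , x≢d , y≢d , a≢d , b≢d) =
    move-apexes c v d a≢b a≢d b≢d λ { false → x≢d ; true → y≢d }
  ... | inj₂ (x≢a , x≢b , y≢a , y≢b) =
    let c₁ , r₁ , (x₁≡a , y₁≡y) , frame₁ = move-apexes c v b (y≢a ∘ sym) a≢b y≢b λ { false → x≢b ; true → y≢b }
        c₂ , r₂ , at₂ , frame₂ = move-apexes c₁ v (colour c (apex v false)) a≢b (x≢a ∘ sym) (x≢b ∘ sym)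
          λ { false e → x≢a (trans (sym e) x₁≡a) ; true e → x≢y (trans (sym e) y₁≡y) }
    in c₂ , r₁ ◅◅ r₂ , at₂ , λ u b′ u≢v → trans (frame₂ u b′ u≢v) (frame₁ u b′ u≢v)
    where
    x≢y : colour c (apex v false) ≢ colour c (apex v true)
    x≢y = proj₂ c (apex v false) (apex v true) (refl , λ ())

  normalise-all-apexes : ∀ c → Σ (Coloring (G **) 4) λ c′ → c ⇝* c′ × ∀ v → ApexesAt c′ v 0F 1F
  normalise-all-apexes c =
    let c′ , c⇝*c′ , _ , done = satisfy-all (λ _ → ⊤) (λ c′ v → ApexesAt c′ v 0F 1F) step (allFin n) c tt
    in c′ , c⇝*c′ , λ v → done v (∈-allFin v)
    where
    step : ∀ c′ → ⊤ → ∀ v → Σ (Coloring (G **) 4) λ c″ → c′ ⇝* c″ × ⊤ × ApexesAt c″ v 0F 1F ×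
      (∀ u → ApexesAt c′ u 0F 1F → ApexesAt c″ u 0F 1F)
    step c′ _ v with normalise-apexes c′ v (λ ())
    ... | c″ , c′⇝*c″ , at , frame = c″ , c′⇝*c″ , tt , at , keep
      where
      keep : ∀ u → ApexesAt c′ u 0F 1F → ApexesAt c″ u 0F 1F
      keep u (x≡0 , y≡1) with u ≟ v
      ... | yes refl = at
      ... | no u≢v = trans (frame u false u≢v) x≡0 , trans (frame u true u≢v) y≡1

  canonical : VStarStar G → Fin 4
  canonical (inj₂ (_ , false)) = 0F
  canonical (inj₂ (_ , true)) = 1F
  canonical (inj₁ ((v , w) , _)) with v <? w
  ... | yes _ = 2F
  ... | no _ = 3F

  canonical-apexes⇒≢2F : ∀ c v → ApexesAt c v 0F 1F → ∀ b → colour c (apex v b) ≢ 2F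
  canonical-apexes⇒≢2F c v (x≡0 , _) false rewrite x≡0 = λ ()
  canonical-apexes⇒≢2F c v (_ , y≡1) true rewrite y≡1 = λ ()

  ≡-canonical : ∀ c → (∀ v → ApexesAt c v 0F 1F) →
    (∀ {v w} → v < w → ∀ t → colour c (half v w t) ≡ 2F) → ∀ u → colour c u ≡ canonical u
  ≡-canonical c apexes halves (inj₂ (v , false)) = proj₁ (apexes v)
  ≡-canonical c apexes halves (inj₂ (v , true)) = proj₂ (apexes v)
  ≡-canonical c apexes halves (inj₁ ((v , w) , t)) with v <? w
  ... | yes v<w = halves v<w t
  ... | no v≮w = forced-3F
    (λ e → proj₂ c (half v w t) (apex v false) refl (trans e (sym (proj₁ (apexes v)))))
    (λ e → proj₂ c (half v w t) (apex v true) refl (trans e (sym (proj₂ (apexes v)))))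
    (λ e → proj₂ c (half v w t) (half w v (flip t)) (refl , refl) (trans e (sym (halves w<v (flip t)))))
    where
    w<v : w < v
    w<v with <-cmp v w
    ... | tri< v<w _ _ = contradiction v<w v≮w
    ... | tri≈ _ refl _ = contradiction t no-loop
    ... | tri> _ _ w<v = w<v

  reach-canonical : ∀ c → Σ (Coloring (G **) 4) λ c′ → c ⇝* c′ × (∀ u → colour c′ u ≡ canonical u)
  reach-canonical c =
    let c₁ , r₁ , apexes₁ = normalise-all-apexes c
        c₂ , r₂ , kept₂ , halves₂ = recolour-halves _<_ _<?_ (λ _ → <-asym) c₁ 2F
          (λ {v} _ → canonical-apexes⇒≢2F c₁ v (apexes₁ v))
        apexes₂ = λ v → trans (kept₂ v false) (proj₁ (apexes₁ v)) , trans (kept₂ v true) (proj₂ (apexes₁ v))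
    in c₂ , r₁ ◅◅ r₂ , ≡-canonical c₂ apexes₂ halves₂

theorem4 : (G : SimpleGraph) → Connected G →
    (α β : Coloring (G **) 4) → KempeEquivalent (G **) 4 α β
theorem4 G _ = reach-common⇒KempeEquivalent canonical reach-canonical
  where open DoubleStar G
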